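{- Let $k\geq 2$, let $\alpha_1,\ldots,\alpha_{2k}$ be positive integers with $\alpha_{2k}\geq 2$, and let $G=C(\alpha_1,\ldots,\alpha_{2k})$. Then: (1) $-2$ is an eigenvalue of $\epsilon(G)$ with multiplicity at least $\alpha_2+\alpha_4+\cdots+\alpha_{2k}-k$; (2) $0$ is an eigenvalue of $\epsilon(G)$ with multiplicity at least $\alpha_1+\alpha_3+\cdots+\alpha_{2k-1}-k$; (3) $2(\alpha_{2k}-1)$ is an eigenvalue of $\epsilon(G)$ with multiplicity at least $1$.
   Context: For a positive integer $\alpha$, $K_\alpha$ is the complete graph on $\alpha$ vertices and $\overline{H}$ denotes the complement of a graph $H$. For positive integers $\alpha_1,\ldots,\alpha_l$ the graph $C(\alpha_1,\ldots,\alpha_l)$ is defined recursively by $C(\alpha_1)=\overline{K_{\alpha_1}}$ and $C(\alpha_1,\ldots,\alpha_i)=\overline{C(\alpha_1,\ldots,\alpha_{i-1})\cup K_{\alpha_i}}$ for $2\leq i\leq l$ (disjoint union, then complement). For a connected graph $G$ with distance $d(u,v)$ and eccentricity $e(u)=\max_v d(u,v)$, the eccentricity matrix $\epsilon(G)$ is the matrix indexed by $V(G)$ with $(u,v)$-entry $d(u,v)$ if $d(u,v)=\min\{e(u),e(v)\}$ and $0$ otherwise. -}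

module Defs where

open import Data.Bool using (Bool; true; false; not; _∧_; _∨_; if_then_else_)
open import Data.Nat as ℕ using (ℕ; zero; suc; _⊔_; _⊓_; _%_; _∸_)
open import Data.Fin using (Fin; zero; suc; inject₁; fromℕ; toℕ; splitAt)
open import Data.Fin.Properties using () renaming (_≟_ to _≟ᶠ_)
open import Data.Sum using (inj₁; inj₂)
open import Data.Integer using (+_)
open import Data.Rational using (ℚ; _/_; 0ℚ; _+_; _*_)
open import Relation.Nullary using (does)
open import Relation.Binary.PropositionalEquality using (_≡_)

-- Simple graphs on vertex set Fin n, given by a Boolean adjacency
-- function (only off-diagonal entries are meaningful; we keep the
-- diagonal false in all constructions below).

Graph : ℕ → Set
Graph n = Fin n → Fin n → Bool

emptyG : (n : ℕ) → Graph n
emptyG n u v = false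

completeG : (n : ℕ) → Graph n
completeG n u v = not (does (u ≟ᶠ v))

complementG : {n : ℕ} → Graph n → Graph n
complementG A u v = if does (u ≟ᶠ v) then false else not (A u v)

unionG : {m n : ℕ} → Graph m → Graph n → Graph (m ℕ.+ n)
unionG {m} A B u v with splitAt m u | splitAt m v
... | inj₁ x | inj₁ y = A x y
... | inj₂ x | inj₂ y = B x y
... | _      | _      = false

-- The graph C(α₁,…,α_l), with α given 0-based as α : Fin l → ℕ.

Csize : (l : ℕ) → (Fin l → ℕ) → ℕ
Csize zero α = 0
Csize (suc l) α = Csize l (λ i → α (inject₁ i)) ℕ.+ α (fromℕ l)

C : (l : ℕ) → (α : Fin l → ℕ) → Graph (Csize l α)
C zero α = emptyG 0
C (suc zero) α = emptyG (0 ℕ.+ α zero)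
C (suc (suc l)) α =
  complementG (unionG (C (suc l) (λ i → α (inject₁ i)))
                      (completeG (α (fromℕ (suc l)))))

anyFin : (n : ℕ) → (Fin n → Bool) → Bool
anyFin zero f = false
anyFin (suc n) f = f zero ∨ anyFin n (λ i → f (suc i))

maxFin : (n : ℕ) → (Fin n → ℕ) → ℕ
maxFin zero f = 0
maxFin (suc n) f = f zero ⊔ maxFin n (λ i → f (suc i))

sumℕ : (n : ℕ) → (Fin n → ℕ) → ℕ
sumℕ zero f = 0
sumℕ (suc n) f = f zero ℕ.+ sumℕ n (λ i → f (suc i))

sumℚ : (n : ℕ) → (Fin n → ℚ) → ℚ
sumℚ zero f = 0ℚ
sumℚ (suc n) f = f zero + sumℚ n (λ i → f (suc i))

-- least t < b with p t, or b if there is none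
firstTrue : ℕ → (ℕ → Bool) → ℕ
firstTrue zero p = 0
firstTrue (suc b) p = if p 0 then 0 else suc (firstTrue b (λ t → p (suc t)))

reach : {n : ℕ} → Graph n → ℕ → Fin n → Fin n → Bool
reach A zero u v = does (u ≟ᶠ v)
reach {n} A (suc t) u v = reach A t u v ∨ anyFin n (λ w → reach A t u w ∧ A w v)

-- d(u,v): length of a shortest u–v path (for connected graphs on n
-- vertices this is < n, so the search bound n is never hit)
dist : {n : ℕ} → Graph n → Fin n → Fin n → ℕ
dist {n} A u v = firstTrue n (λ t → reach A t u v)

ecc : {n : ℕ} → Graph n → Fin n → ℕ
ecc {n} A u = maxFin n (λ v → dist A u v)

ℕtoℚ : ℕ → ℚ
ℕtoℚ k = (+ k) / 1

eccMatrix : {n : ℕ} → Graph n → Fin n → Fin n → ℚ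
eccMatrix A u v =
  if does (dist A u v ℕ.≟ (ecc A u ⊓ ecc A v)) then ℕtoℚ (dist A u v) else 0ℚ

-- Eigenvalue multiplicity (over ℚ): λ is an eigenvalue of M with
-- multiplicity at least m iff there are m linearly independent vectors
-- x with M x = λ x.  (M is symmetric, so geometric = algebraic
-- multiplicity; for rational M and λ the eigenspace dimension over ℚ
-- equals that over ℝ.)

IsEigenvector : {n : ℕ} → (Fin n → Fin n → ℚ) → ℚ → (Fin n → ℚ) → Set
IsEigenvector {n} M λ₀ x = ∀ u → sumℚ n (λ v → M u v * x v) ≡ λ₀ * x u

LinIndep : {n m : ℕ} → (Fin m → Fin n → ℚ) → Set
LinIndep {n} {m} xs =
  (c : Fin m → ℚ) → (∀ v → sumℚ m (λ i → c i * xs i v) ≡ 0ℚ) → ∀ i → c i ≡ 0ℚ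

EigenMultAtLeast : {n : ℕ} → (Fin n → Fin n → ℚ) → ℚ → ℕ → Set
EigenMultAtLeast {n} M λ₀ m =
  Data.Product.Σ (Fin m → Fin n → ℚ) (λ xs →
    (∀ i → IsEigenvector M λ₀ (xs i)) Data.Product.× LinIndep xs)
  where import Data.Product

-- sums of α over 0-based even / odd positions
-- (0-based even = 1-based odd: α₁+α₃+…; 0-based odd = α₂+α₄+…)
sumOddPos : (l : ℕ) → (Fin l → ℕ) → ℕ
sumOddPos l α = sumℕ l (λ i → if does (toℕ i % 2 ℕ.≟ 0) then α i else 0)

sumEvenPos : (l : ℕ) → (Fin l → ℕ) → ℕ
sumEvenPos l α = sumℕ l (λ i → if does (toℕ i % 2 ℕ.≟ 1) then α i else 0)

{-# OPTIONS --safe #-}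
module Submission where

-- With at least three parts and a last part of size at least two, every vertex of G = C(α₁,…,α_{2k})
-- has eccentricity 2, so ε(G) is twice the adjacency matrix of the complement of G. Every part of G
-- consists of pairwise twins and is an independent set for even i and a clique for odd i. For twins
-- a, b the vector e_b − e_a is an eigenvector of ε(G) with eigenvalue −2 if a, b are non-adjacent and
-- 0 if they are adjacent; pairing one vertex of a part with each of the others gives α_i − 1 linearly
-- independent such vectors. Finally the last part is an independent set joined to every other vertex,
-- so its indicator vector is an eigenvector of ε(G) with eigenvalue 2(α_{2k} − 1).

open import Defs

open import Algebra.Bundles using (CommutativeMonoid)
open import Data.Bool using (Bool; true; false; not; _∧_; _∨_; if_then_else_)
open import Data.Bool.Properties using (∨-zeroʳ; ∨-identityʳ)
open import Data.Empty using (⊥-elim)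
open import Data.Fin using (Fin; zero; suc; fromℕ<; _↑ˡ_; _↑ʳ_; splitAt; inject₁; fromℕ; toℕ)
open import Data.Fin.Properties
  using ( _≟_; suc-injective; toℕ<n; ↑ˡ-injective; ↑ʳ-injective; splitAt-↑ˡ; splitAt-↑ʳ
        ; splitAt⁻¹-↑ˡ; splitAt⁻¹-↑ʳ; toℕ-inject₁; toℕ-fromℕ)
open import Data.Integer using (-[1+_])
import Data.Integer as ℤ
import Data.Integer.Properties as ℤ
open import Data.Nat using (ℕ; zero; suc; pred; _+_; _*_; _∸_; _≤_; _<_; z≤n; s≤s; _%_)
import Data.Nat as ℕ
import Data.Nat.Properties as ℕ
open import Data.Nat.DivMod using ([m+kn]%n≡m%n)
open import Data.Nat.Tactic.RingSolver using (solve-∀)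
open import Data.Product using (∃-syntax; _×_; _,_; proj₁; proj₂)
open import Data.Rational using (ℚ; 0ℚ; 1ℚ; _/_)
import Data.Rational as ℚ
import Data.Rational.Properties as ℚ
open import Data.Rational.Literals using (fromℤ)
open import Data.Rational.Solver using (module +-*-Solver)
open import Data.Sum using (inj₁; inj₂)
open import Data.Vec.Functional using (replicate; _++_)
open import Data.Vec.Functional.Properties using (lookup-++ˡ; lookup-++ʳ)
open import Function using (_∘_)
open import Relation.Binary.PropositionalEquality
open import Relation.Nullary using (does; yes; no)
open import Relation.Nullary.Decidable using (dec-true; dec-false)

open +-*-Solver using (solve; _:+_; _:*_; _:-_; :-_; _:=_; con)

private
  variable
    n m k : ℕ

data Side (n m : ℕ) : Fin (n + m) → Set where
  left  : (x : Fin n) → Side n m (x ↑ˡ m)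
  right : (p : Fin m) → Side n m (n ↑ʳ p)

side : ∀ n m (u : Fin (n + m)) → Side n m u
side n m u with splitAt n u in eq
... | inj₁ x = subst (Side n m) (splitAt⁻¹-↑ˡ eq) (left x)
... | inj₂ p = subst (Side n m) (splitAt⁻¹-↑ʳ eq) (right p)

↑ˡ≢↑ʳ : ∀ (x : Fin n) (p : Fin m) → x ↑ˡ m ≢ n ↑ʳ p
↑ˡ≢↑ʳ {n} {m} x p eq with trans (sym (splitAt-↑ˡ n x m)) (trans (cong (splitAt n) eq) (splitAt-↑ʳ n m p))
... | ()

sumℚ-cong : ∀ n {f g : Fin n → ℚ} → (∀ v → f v ≡ g v) → sumℚ n f ≡ sumℚ n g
sumℚ-cong zero    f≗g = refl
sumℚ-cong (suc n) f≗g = cong₂ ℚ._+_ (f≗g zero) (sumℚ-cong n (f≗g ∘ suc))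

sumℚ-zero : ∀ n → sumℚ n (λ _ → 0ℚ) ≡ 0ℚ
sumℚ-zero zero    = refl
sumℚ-zero (suc n) = trans (ℚ.+-identityˡ _) (sumℚ-zero n)

sumℚ-+ : ∀ n (f g : Fin n → ℚ) → sumℚ n (λ v → f v ℚ.+ g v) ≡ sumℚ n f ℚ.+ sumℚ n g
sumℚ-+ zero    f g = refl
sumℚ-+ (suc n) f g = trans (cong ((f zero ℚ.+ g zero) ℚ.+_) (sumℚ-+ n (f ∘ suc) (g ∘ suc)))
                           (+-interchange (f zero) (g zero) (sumℚ n (f ∘ suc)) (sumℚ n (g ∘ suc)))
  where
  open import Algebra.Properties.CommutativeSemigroup
    (CommutativeMonoid.commutativeSemigroup ℚ.+-0-commutativeMonoid) using () renaming (interchange to +-interchange)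

sumℚ-↑ : ∀ n m (f : Fin (n + m) → ℚ) →
         sumℚ (n + m) f ≡ sumℚ n (λ x → f (x ↑ˡ m)) ℚ.+ sumℚ m (λ p → f (n ↑ʳ p))
sumℚ-↑ zero    m f = sym (ℚ.+-identityˡ _)
sumℚ-↑ (suc n) m f = trans (cong (f zero ℚ.+_) (sumℚ-↑ n m (f ∘ suc))) (sym (ℚ.+-assoc (f zero) _ _))

unitVec : Fin n → Fin n → ℚ
unitVec a v = if does (a ≟ v) then 1ℚ else 0ℚ

sumℚ-unitVec : ∀ n (f : Fin n → ℚ) a → sumℚ n (λ v → f v ℚ.* unitVec a v) ≡ f a
sumℚ-unitVec (suc n) f zero = begin
  f zero ℚ.* 1ℚ ℚ.+ sumℚ n (λ v → f (suc v) ℚ.* 0ℚ)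
    ≡⟨ cong₂ ℚ._+_ (ℚ.*-identityʳ (f zero)) (sumℚ-cong n (ℚ.*-zeroʳ ∘ f ∘ suc)) ⟩
  f zero ℚ.+ sumℚ n (λ _ → 0ℚ)   ≡⟨ cong (f zero ℚ.+_) (sumℚ-zero n) ⟩
  f zero ℚ.+ 0ℚ                   ≡⟨ ℚ.+-identityʳ (f zero) ⟩
  f zero                          ∎
  where open ≡-Reasoning
sumℚ-unitVec (suc n) f (suc a) =
  trans (cong₂ ℚ._+_ (ℚ.*-zeroʳ (f zero)) (sumℚ-unitVec n (f ∘ suc) a)) (ℚ.+-identityˡ _)

linIndep-dual : (xs : Fin m → Fin n → ℚ) (b : Fin m → Fin n) →
                (∀ i j → xs i (b j) ≡ unitVec j i) → LinIndep xs
linIndep-dual {m} xs b dual c combination≡0 j = begin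
  c j                                   ≡⟨ sumℚ-unitVec m c j ⟨
  sumℚ m (λ i → c i ℚ.* unitVec j i)   ≡⟨ sumℚ-cong m (λ i → cong (c i ℚ.*_) (dual i j)) ⟨
  sumℚ m (λ i → c i ℚ.* xs i (b j))    ≡⟨ combination≡0 (b j) ⟩
  0ℚ                                    ∎
  where open ≡-Reasoning

record TwinPair {A : Set} (M : Fin n → Fin n → A) (c : A) (a b : Fin n) : Set where
  field
    distinct : a ≢ b
    entry-ab : M a b ≡ c
    entry-ba : M b a ≡ c
    twins    : ∀ u → u ≢ a → u ≢ b → M u a ≡ M u b

record TwinFamily {A : Set} (M : Fin n → Fin n → A) (c : A) (k : ℕ) : Set where
  field
    pivot partner     : Fin k → Fin n
    twinPair          : ∀ i → TwinPair M c (pivot i) (partner i)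
    partner-injective : ∀ {i j} → partner i ≡ partner j → i ≡ j
    pivot≢partner     : ∀ i j → pivot i ≢ partner j

twinVec : Fin n → Fin n → Fin n → ℚ
twinVec a b v = unitVec b v ℚ.- unitVec a v

sumℚ-twinVec : ∀ n (f : Fin n → ℚ) a b → sumℚ n (λ v → f v ℚ.* twinVec a b v) ≡ f b ℚ.- f a
sumℚ-twinVec n f a b = begin
  sumℚ n (λ v → f v ℚ.* twinVec a b v)
    ≡⟨ sumℚ-cong n distrib ⟩
  sumℚ n (λ v → f v ℚ.* unitVec b v ℚ.+ (ℚ.- f v) ℚ.* unitVec a v)
    ≡⟨ sumℚ-+ n _ _ ⟩
  sumℚ n (λ v → f v ℚ.* unitVec b v) ℚ.+ sumℚ n (λ v → (ℚ.- f v) ℚ.* unitVec a v)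
    ≡⟨ cong₂ ℚ._+_ (sumℚ-unitVec n f b) (sumℚ-unitVec n (ℚ.-_ ∘ f) a) ⟩
  f b ℚ.- f a
    ∎
  where
  open ≡-Reasoning
  distrib : ∀ v → f v ℚ.* twinVec a b v ≡ f v ℚ.* unitVec b v ℚ.+ (ℚ.- f v) ℚ.* unitVec a v
  distrib v = solve 3 (λ x e d → x :* (e :- d) := x :* e :+ (:- x) :* d) refl (f v) (unitVec b v) (unitVec a v)

twinVec-eigenvector : {M : Fin n → Fin n → ℚ} {c : ℚ} {a b : Fin n} → (∀ u → M u u ≡ 0ℚ) →
                      TwinPair M c a b → IsEigenvector M (ℚ.- c) (twinVec a b)
twinVec-eigenvector {n} {M} {c} {a} {b} diag twin u = trans (sumℚ-twinVec n (M u) a b) (eigenEquation u)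
  where
  open TwinPair twin
  eigenEquation : ∀ u → M u b ℚ.- M u a ≡ (ℚ.- c) ℚ.* twinVec a b u
  eigenEquation u with a ≟ u | b ≟ u
  ... | yes refl | yes refl = ⊥-elim (distinct refl)
  ... | yes refl | no _ rewrite entry-ab | diag a =
    solve 1 (λ c → c :- con 0ℚ := (:- c) :* (con 0ℚ :- con 1ℚ)) refl c
  ... | no _ | yes refl rewrite entry-ba | diag b =
    solve 1 (λ c → con 0ℚ :- c := (:- c) :* (con 1ℚ :- con 0ℚ)) refl c
  ... | no a≢u | no b≢u rewrite twins u (a≢u ∘ sym) (b≢u ∘ sym) =
    trans (ℚ.+-inverseʳ (M u b)) (sym (ℚ.*-zeroʳ (ℚ.- c)))

twinFamily-eigenMult : {M : Fin n → Fin n → ℚ} {c : ℚ} → (∀ u → M u u ≡ 0ℚ) →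
                       TwinFamily M c k → EigenMultAtLeast M (ℚ.- c) k
twinFamily-eigenMult diag family =
  (λ i → twinVec (pivot i) (partner i)) , (λ i → twinVec-eigenvector diag (twinPair i)) ,
  linIndep-dual _ partner dual
  where
  open TwinFamily family
  dual : ∀ i j → twinVec (pivot i) (partner i) (partner j) ≡ unitVec j i
  dual i j with i ≟ j
  ... | yes refl rewrite dec-true (partner i ≟ partner i) refl
                       | dec-false (pivot i ≟ partner i) (pivot≢partner i i)
                       | dec-true (i ≟ i) refl = refl
  ... | no i≢j   rewrite dec-false (partner i ≟ partner j) (i≢j ∘ partner-injective)
                       | dec-false (pivot i ≟ partner j) (pivot≢partner i j)
                       | dec-false (j ≟ i) (i≢j ∘ sym) = refl

rightIndicator : ∀ n m → Fin (n + m) → ℚ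
rightIndicator n m = replicate n 0ℚ ++ replicate m 1ℚ

rightIndicator-↑ˡ : ∀ (x : Fin n) → rightIndicator n m (x ↑ˡ m) ≡ 0ℚ
rightIndicator-↑ˡ {n} {m} = lookup-++ˡ (replicate n 0ℚ) (replicate m 1ℚ)

rightIndicator-↑ʳ : ∀ n (p : Fin m) → rightIndicator n m (n ↑ʳ p) ≡ 1ℚ
rightIndicator-↑ʳ {m} n = lookup-++ʳ (replicate n 0ℚ) (replicate m 1ℚ)

rightIndicator-eigenvector : (M : Fin (n + m) → Fin (n + m) → ℚ) (μ : ℚ) →
  (∀ x q → M (x ↑ˡ m) (n ↑ʳ q) ≡ 0ℚ) → (∀ p → sumℚ m (λ q → M (n ↑ʳ p) (n ↑ʳ q)) ≡ μ) →
  IsEigenvector M μ (rightIndicator n m)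
rightIndicator-eigenvector {n} {m} M μ offBlock≡0 blockRowSum u = begin
  sumℚ (n + m) (λ v → M u v ℚ.* rightIndicator n m v)  ≡⟨ sumℚ-↑ n m _ ⟩
  leftPart ℚ.+ rightPart                                ≡⟨ cong₂ ℚ._+_ leftPart≡0 rightPart≡rowSum ⟩
  0ℚ ℚ.+ sumℚ m (λ q → M u (n ↑ʳ q))                   ≡⟨ ℚ.+-identityˡ _ ⟩
  sumℚ m (λ q → M u (n ↑ʳ q))                          ≡⟨ rowSum u (side n m u) ⟩
  μ ℚ.* rightIndicator n m u                            ∎
  where
  open ≡-Reasoning
  leftPart rightPart : ℚ
  leftPart  = sumℚ n (λ x → M u (x ↑ˡ m) ℚ.* rightIndicator n m (x ↑ˡ m))
  rightPart = sumℚ m (λ q → M u (n ↑ʳ q) ℚ.* rightIndicator n m (n ↑ʳ q))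

  leftPart≡0 : leftPart ≡ 0ℚ
  leftPart≡0 = trans (sumℚ-cong n (λ x → trans (cong (M u (x ↑ˡ m) ℚ.*_) (rightIndicator-↑ˡ x))
                                               (ℚ.*-zeroʳ (M u (x ↑ˡ m)))))
                     (sumℚ-zero n)

  rightPart≡rowSum : rightPart ≡ sumℚ m (λ q → M u (n ↑ʳ q))
  rightPart≡rowSum = sumℚ-cong m (λ q → trans (cong (M u (n ↑ʳ q) ℚ.*_) (rightIndicator-↑ʳ n q))
                                               (ℚ.*-identityʳ (M u (n ↑ʳ q))))

  rowSum : ∀ u → Side n m u → sumℚ m (λ q → M u (n ↑ʳ q)) ≡ μ ℚ.* rightIndicator n m u
  rowSum _ (left x)  = begin
    sumℚ m (λ q → M (x ↑ˡ m) (n ↑ʳ q))  ≡⟨ trans (sumℚ-cong m (offBlock≡0 x)) (sumℚ-zero m) ⟩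
    0ℚ                                   ≡⟨ ℚ.*-zeroʳ μ ⟨
    μ ℚ.* 0ℚ                             ≡⟨ cong (μ ℚ.*_) (rightIndicator-↑ˡ x) ⟨
    μ ℚ.* rightIndicator n m (x ↑ˡ m)    ∎
  rowSum _ (right p) = begin
    sumℚ m (λ q → M (n ↑ʳ p) (n ↑ʳ q))  ≡⟨ blockRowSum p ⟩
    μ                                    ≡⟨ ℚ.*-identityʳ μ ⟨
    μ ℚ.* 1ℚ                             ≡⟨ cong (μ ℚ.*_) (rightIndicator-↑ʳ n p) ⟨
    μ ℚ.* rightIndicator n m (n ↑ʳ p)    ∎

rightIndicator-eigenMult : (M : Fin (n + m) → Fin (n + m) → ℚ) (μ : ℚ) → Fin m →
  (∀ x q → M (x ↑ˡ m) (n ↑ʳ q) ≡ 0ℚ) → (∀ p → sumℚ m (λ q → M (n ↑ʳ p) (n ↑ʳ q)) ≡ μ) →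
  EigenMultAtLeast M μ 1
rightIndicator-eigenMult {n} {m} M μ p offBlock≡0 blockRowSum =
  (λ _ → rightIndicator n m) , (λ _ → rightIndicator-eigenvector M μ offBlock≡0 blockRowSum) ,
  linIndep-dual (λ _ → rightIndicator n m) (λ _ → n ↑ʳ p) (λ { zero zero → rightIndicator-↑ʳ n p })

complementG-≢ : ∀ (G : Graph n) {u v} → u ≢ v → complementG G u v ≡ not (G u v)
complementG-≢ G {u} {v} u≢v rewrite dec-false (u ≟ v) u≢v = refl

module _ (H : Graph n) (K : Graph m) where

  unionG-↑ˡ↑ˡ : ∀ x y → unionG H K (x ↑ˡ m) (y ↑ˡ m) ≡ H x y
  unionG-↑ˡ↑ˡ x y rewrite splitAt-↑ˡ n x m | splitAt-↑ˡ n y m = refl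

  unionG-↑ˡ↑ʳ : ∀ x q → unionG H K (x ↑ˡ m) (n ↑ʳ q) ≡ false
  unionG-↑ˡ↑ʳ x q rewrite splitAt-↑ˡ n x m | splitAt-↑ʳ n m q = refl

  unionG-↑ʳ↑ˡ : ∀ p y → unionG H K (n ↑ʳ p) (y ↑ˡ m) ≡ false
  unionG-↑ʳ↑ˡ p y rewrite splitAt-↑ʳ n m p | splitAt-↑ˡ n y m = refl

  unionG-↑ʳ↑ʳ : ∀ p q → unionG H K (n ↑ʳ p) (n ↑ʳ q) ≡ K p q
  unionG-↑ʳ↑ʳ p q rewrite splitAt-↑ʳ n m p | splitAt-↑ʳ n m q = refl

module _ {A B : Set} (f : A → B) {M : Fin n → Fin n → A} {N : Fin n → Fin n → B}
         (N≡f∘M : ∀ {u v} → u ≢ v → N u v ≡ f (M u v)) {c : A} where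

  twinPair-map : ∀ {a b} → TwinPair M c a b → TwinPair N (f c) a b
  twinPair-map twin = record
    { distinct = distinct
    ; entry-ab = trans (N≡f∘M distinct) (cong f entry-ab)
    ; entry-ba = trans (N≡f∘M (distinct ∘ sym)) (cong f entry-ba)
    ; twins    = λ u u≢a u≢b → trans (N≡f∘M u≢a) (trans (cong f (twins u u≢a u≢b)) (sym (N≡f∘M u≢b)))
    }
    where open TwinPair twin

  twinFamily-map : TwinFamily M c k → TwinFamily N (f c) k
  twinFamily-map family = record
    { pivot = pivot ; partner = partner ; twinPair = twinPair-map ∘ twinPair
    ; partner-injective = partner-injective ; pivot≢partner = pivot≢partner }
    where open TwinFamily family

twinFamily-complement : {G : Graph n} {β : Bool} → TwinFamily G β k → TwinFamily (complementG G) (not β) k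
twinFamily-complement {G = G} = twinFamily-map not (complementG-≢ G)

twinFamily-none : {A : Set} {M : Fin n → Fin n → A} {c : A} → TwinFamily M c 0
twinFamily-none = record
  { pivot = λ () ; partner = λ () ; twinPair = λ () ; partner-injective = λ { {()} } ; pivot≢partner = λ () }

module _ {A : Set} {M : Fin n → Fin n → A} {c : A} {k₁ k₂ : ℕ}
         (F₁ : TwinFamily M c k₁) (F₂ : TwinFamily M c k₂) where
  private
    module F₁ = TwinFamily F₁
    module F₂ = TwinFamily F₂

  twinFamily-++ : (∀ i j → F₁.pivot i ≢ F₂.partner j) → (∀ i j → F₂.pivot i ≢ F₁.partner j) →
                  (∀ i j → F₁.partner i ≢ F₂.partner j) → TwinFamily M c (k₁ + k₂)
  twinFamily-++ pivot₁≢partner₂ pivot₂≢partner₁ partner₁≢partner₂ = record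
    { pivot = pivot ; partner = partner ; twinPair = λ i → twinPair i (side k₁ k₂ i)
    ; partner-injective = λ {i} {j} → partner-injective (side k₁ k₂ i) (side k₁ k₂ j)
    ; pivot≢partner = λ i j → pivot≢partner (side k₁ k₂ i) (side k₁ k₂ j) }
    where
    pivot partner : Fin (k₁ + k₂) → Fin n
    pivot   = F₁.pivot ++ F₂.pivot
    partner = F₁.partner ++ F₂.partner

    twinPair : ∀ i → Side k₁ k₂ i → TwinPair M c (pivot i) (partner i)
    twinPair _ (left x)
      rewrite lookup-++ˡ F₁.pivot F₂.pivot x | lookup-++ˡ F₁.partner F₂.partner x = F₁.twinPair x
    twinPair _ (right x)
      rewrite lookup-++ʳ F₁.pivot F₂.pivot x | lookup-++ʳ F₁.partner F₂.partner x = F₂.twinPair x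

    partner-injective : ∀ {i j} → Side k₁ k₂ i → Side k₁ k₂ j → partner i ≡ partner j → i ≡ j
    partner-injective (left x) (left y)
      rewrite lookup-++ˡ F₁.partner F₂.partner x | lookup-++ˡ F₁.partner F₂.partner y =
      cong (_↑ˡ k₂) ∘ F₁.partner-injective
    partner-injective (left x) (right y)
      rewrite lookup-++ˡ F₁.partner F₂.partner x | lookup-++ʳ F₁.partner F₂.partner y =
      ⊥-elim ∘ partner₁≢partner₂ x y
    partner-injective (right x) (left y)
      rewrite lookup-++ʳ F₁.partner F₂.partner x | lookup-++ˡ F₁.partner F₂.partner y =
      ⊥-elim ∘ partner₁≢partner₂ y x ∘ sym
    partner-injective (right x) (right y)
      rewrite lookup-++ʳ F₁.partner F₂.partner x | lookup-++ʳ F₁.partner F₂.partner y =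
      cong (k₁ ↑ʳ_) ∘ F₂.partner-injective

    pivot≢partner : ∀ {i j} → Side k₁ k₂ i → Side k₁ k₂ j → pivot i ≢ partner j
    pivot≢partner (left x) (left y)
      rewrite lookup-++ˡ F₁.pivot F₂.pivot x | lookup-++ˡ F₁.partner F₂.partner y = F₁.pivot≢partner x y
    pivot≢partner (left x) (right y)
      rewrite lookup-++ˡ F₁.pivot F₂.pivot x | lookup-++ʳ F₁.partner F₂.partner y = pivot₁≢partner₂ x y
    pivot≢partner (right x) (left y)
      rewrite lookup-++ʳ F₁.pivot F₂.pivot x | lookup-++ˡ F₁.partner F₂.partner y = pivot₂≢partner₁ x y
    pivot≢partner (right x) (right y)
      rewrite lookup-++ʳ F₁.pivot F₂.pivot x | lookup-++ʳ F₁.partner F₂.partner y = F₂.pivot≢partner x y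

module _ {H : Graph n} {K : Graph m} {β : Bool} where

  twinPair-unionˡ : ∀ {a b} → TwinPair H β a b → TwinPair (unionG H K) β (a ↑ˡ m) (b ↑ˡ m)
  twinPair-unionˡ {a} {b} twin = record
    { distinct = distinct ∘ ↑ˡ-injective m a b
    ; entry-ab = trans (unionG-↑ˡ↑ˡ H K a b) entry-ab
    ; entry-ba = trans (unionG-↑ˡ↑ˡ H K b a) entry-ba
    ; twins    = λ u u≢a u≢b → twins′ u (side n m u) u≢a u≢b
    }
    where
    open TwinPair twin
    twins′ : ∀ u → Side n m u → u ≢ a ↑ˡ m → u ≢ b ↑ˡ m → unionG H K u (a ↑ˡ m) ≡ unionG H K u (b ↑ˡ m)
    twins′ _ (left y) y≢a y≢b = begin
      unionG H K (y ↑ˡ m) (a ↑ˡ m) ≡⟨ unionG-↑ˡ↑ˡ H K y a ⟩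
      H y a                        ≡⟨ twins y (y≢a ∘ cong (_↑ˡ m)) (y≢b ∘ cong (_↑ˡ m)) ⟩
      H y b                        ≡⟨ unionG-↑ˡ↑ˡ H K y b ⟨
      unionG H K (y ↑ˡ m) (b ↑ˡ m) ∎
      where open ≡-Reasoning
    twins′ _ (right p) _ _ = trans (unionG-↑ʳ↑ˡ H K p a) (sym (unionG-↑ʳ↑ˡ H K p b))

  twinPair-unionʳ : ∀ {a b} → TwinPair K β a b → TwinPair (unionG H K) β (n ↑ʳ a) (n ↑ʳ b)
  twinPair-unionʳ {a} {b} twin = record
    { distinct = distinct ∘ ↑ʳ-injective n a b
    ; entry-ab = trans (unionG-↑ʳ↑ʳ H K a b) entry-ab
    ; entry-ba = trans (unionG-↑ʳ↑ʳ H K b a) entry-ba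
    ; twins    = λ u u≢a u≢b → twins′ u (side n m u) u≢a u≢b
    }
    where
    open TwinPair twin
    twins′ : ∀ u → Side n m u → u ≢ n ↑ʳ a → u ≢ n ↑ʳ b → unionG H K u (n ↑ʳ a) ≡ unionG H K u (n ↑ʳ b)
    twins′ _ (left y) _ _ = trans (unionG-↑ˡ↑ʳ H K y a) (sym (unionG-↑ˡ↑ʳ H K y b))
    twins′ _ (right p) p≢a p≢b = begin
      unionG H K (n ↑ʳ p) (n ↑ʳ a) ≡⟨ unionG-↑ʳ↑ʳ H K p a ⟩
      K p a                        ≡⟨ twins p (p≢a ∘ cong (n ↑ʳ_)) (p≢b ∘ cong (n ↑ʳ_)) ⟩
      K p b                        ≡⟨ unionG-↑ʳ↑ʳ H K p b ⟨
      unionG H K (n ↑ʳ p) (n ↑ʳ b) ∎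
      where open ≡-Reasoning

  twinFamily-unionˡ : TwinFamily H β k → TwinFamily (unionG H K) β k
  twinFamily-unionˡ family = record
    { pivot = (_↑ˡ m) ∘ pivot ; partner = (_↑ˡ m) ∘ partner ; twinPair = twinPair-unionˡ ∘ twinPair
    ; partner-injective = partner-injective ∘ ↑ˡ-injective m _ _
    ; pivot≢partner = λ i j → pivot≢partner i j ∘ ↑ˡ-injective m _ _ }
    where open TwinFamily family

  twinFamily-unionʳ : TwinFamily K β k → TwinFamily (unionG H K) β k
  twinFamily-unionʳ family = record
    { pivot = (n ↑ʳ_) ∘ pivot ; partner = (n ↑ʳ_) ∘ partner ; twinPair = twinPair-unionʳ ∘ twinPair
    ; partner-injective = partner-injective ∘ ↑ʳ-injective n _ _
    ; pivot≢partner = λ i j → pivot≢partner i j ∘ ↑ʳ-injective n _ _ }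
    where open TwinFamily family

  twinFamily-union : ∀ {k₁ k₂} → TwinFamily H β k₁ → TwinFamily K β k₂ → TwinFamily (unionG H K) β (k₁ + k₂)
  twinFamily-union F₁ F₂ = twinFamily-++ (twinFamily-unionˡ F₁) (twinFamily-unionʳ F₂)
    (λ _ _ → ↑ˡ≢↑ʳ _ _) (λ _ _ → ↑ˡ≢↑ʳ _ _ ∘ sym) (λ _ _ → ↑ˡ≢↑ʳ _ _)

completeG-twinPair : ∀ {a b : Fin m} → a ≢ b → TwinPair (completeG m) true a b
completeG-twinPair {a = a} {b} a≢b = record
  { distinct = a≢b
  ; entry-ab = cong not (dec-false (a ≟ b) a≢b)
  ; entry-ba = cong not (dec-false (b ≟ a) (a≢b ∘ sym))
  ; twins    = λ u u≢a u≢b → trans (cong not (dec-false (u ≟ a) u≢a)) (sym (cong not (dec-false (u ≟ b) u≢b)))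
  }

twinFamily-completeG : ∀ m → TwinFamily (completeG m) true (pred m)
twinFamily-completeG zero    = twinFamily-none
twinFamily-completeG (suc m) = record
  { pivot = λ _ → zero ; partner = suc ; twinPair = λ _ → completeG-twinPair (λ ())
  ; partner-injective = suc-injective ; pivot≢partner = λ _ _ () }

twinFamily-emptyG : ∀ m → TwinFamily (emptyG m) false (pred m)
twinFamily-emptyG m = twinFamily-map not emptyG≡complete (twinFamily-completeG m)
  where
  emptyG≡complete : ∀ {u v} → u ≢ v → emptyG m u v ≡ not (completeG m u v)
  emptyG≡complete {u} {v} u≢v = sym (cong (not ∘ not) (dec-false (u ≟ v) u≢v))

-- Parts that end up independent (β = false) or cliques (β = true) in C(α) contribute α_i − 1 each.
twinCount : ∀ l → (Fin (suc l) → ℕ) → Bool → ℕ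
twinCount zero    α false = pred (α zero)
twinCount zero    α true  = 0
twinCount (suc l) α false = twinCount l (α ∘ inject₁) true + pred (α (fromℕ (suc l)))
twinCount (suc l) α true  = twinCount l (α ∘ inject₁) false

C-twinFamily : ∀ l (α : Fin (suc l) → ℕ) β → TwinFamily (C (suc l) α) β (twinCount l α β)
C-twinFamily zero    α false = twinFamily-emptyG (α zero)
C-twinFamily zero    α true  = twinFamily-none
C-twinFamily (suc l) α false =
  twinFamily-complement (twinFamily-union (C-twinFamily l (α ∘ inject₁) true) (twinFamily-completeG _))
C-twinFamily (suc l) α true  =
  twinFamily-complement (twinFamily-unionˡ (C-twinFamily l (α ∘ inject₁) false))

firstTrue-minimal : ∀ b (p : ℕ → Bool) t → t < b → p t ≡ true → (∀ s → s < t → p s ≡ false) → firstTrue b p ≡ t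
firstTrue-minimal (suc b) p zero    _         pt≡true _ rewrite pt≡true = refl
firstTrue-minimal (suc b) p (suc t) (s≤s t<b) pt≡true below rewrite below 0 (s≤s z≤n) =
  cong suc (firstTrue-minimal b (p ∘ suc) t t<b pt≡true (λ s s<t → below (suc s) (s≤s s<t)))

anyFin-false : ∀ n → anyFin n (λ _ → false) ≡ false
anyFin-false zero    = refl
anyFin-false (suc n) = anyFin-false n

anyFin-select : ∀ n (u : Fin n) (g : Fin n → Bool) → anyFin n (λ w → does (u ≟ w) ∧ g w) ≡ g u
anyFin-select (suc n) zero    g = trans (cong (g zero ∨_) (anyFin-false n)) (∨-identityʳ (g zero))
anyFin-select (suc n) (suc u) g = anyFin-select n u (g ∘ suc)

anyFin-witness : ∀ n (f : Fin n → Bool) w → f w ≡ true → anyFin n f ≡ true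
anyFin-witness (suc n) f zero    fw≡true rewrite fw≡true = refl
anyFin-witness (suc n) f (suc w) fw≡true rewrite anyFin-witness n (f ∘ suc) w fw≡true = ∨-zeroʳ (f zero)

maxFin-attained : ∀ n (f : Fin n → ℕ) c w → (∀ v → f v ≤ c) → f w ≡ c → maxFin n f ≡ c
maxFin-attained n f c w f≤c fw≡c = ℕ.≤-antisym (maxFin≤ n f f≤c) (subst (_≤ maxFin n f) fw≡c (≤maxFin n f w))
  where
  maxFin≤ : ∀ n (f : Fin n → ℕ) → (∀ v → f v ≤ c) → maxFin n f ≤ c
  maxFin≤ zero    f f≤c = z≤n
  maxFin≤ (suc n) f f≤c = ℕ.⊔-lub (f≤c zero) (maxFin≤ n (f ∘ suc) (f≤c ∘ suc))
  ≤maxFin : ∀ n (f : Fin n → ℕ) w → f w ≤ maxFin n f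
  ≤maxFin (suc n) f zero    = ℕ.m≤m⊔n (f zero) _
  ≤maxFin (suc n) f (suc w) = ℕ.≤-trans (≤maxFin n (f ∘ suc) w) (ℕ.m≤n⊔m (f zero) _)

twoIf : Bool → ℚ
twoIf b = if b then ℕtoℚ 2 else 0ℚ

record SelfCentredDiameterTwo (G : Graph n) : Set where
  field
    three≤n         : 3 ≤ n   -- dist G only searches walk lengths below n
    commonNeighbour : ∀ {u v} → u ≢ v → G u v ≡ false → ∃[ w ] G u w ≡ true × G w v ≡ true
    nonNeighbour    : ∀ u → ∃[ v ] u ≢ v × G u v ≡ false

module _ {G : Graph n} (sc : SelfCentredDiameterTwo G) where
  open SelfCentredDiameterTwo sc

  private
    reach-0 : ∀ {u v} → u ≢ v → reach G 0 u v ≡ false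
    reach-0 {u} {v} u≢v = dec-false (u ≟ v) u≢v

    reach-1 : ∀ {u v} → u ≢ v → reach G 1 u v ≡ G u v
    reach-1 {u} {v} u≢v rewrite reach-0 u≢v = anyFin-select n u (λ w → G w v)

    reach-1-adjacent : ∀ {u v} → G u v ≡ true → reach G 1 u v ≡ true
    reach-1-adjacent {u} {v} uv≡true = trans (cong (does (u ≟ v) ∨_) step) (∨-zeroʳ _)
      where
      step : anyFin n (λ w → reach G 0 u w ∧ G w v) ≡ true
      step = anyFin-witness n _ u (cong₂ _∧_ (dec-true (u ≟ u) refl) uv≡true)

  dist-self : ∀ u → dist G u u ≡ 0
  dist-self u = firstTrue-minimal n _ 0 (ℕ.≤-trans (s≤s z≤n) three≤n) (dec-true (u ≟ u) refl) (λ _ ())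

  dist-adjacent : ∀ {u v} → u ≢ v → G u v ≡ true → dist G u v ≡ 1
  dist-adjacent u≢v uv≡true = firstTrue-minimal n _ 1 (ℕ.≤-trans (s≤s (s≤s z≤n)) three≤n)
    (trans (reach-1 u≢v) uv≡true) (λ { zero _ → reach-0 u≢v ; (suc _) (s≤s ()) })

  dist-nonadjacent : ∀ {u v} → u ≢ v → G u v ≡ false → dist G u v ≡ 2
  dist-nonadjacent {u} {v} u≢v uv≡false with commonNeighbour u≢v uv≡false
  ... | w , uw≡true , wv≡true = firstTrue-minimal n _ 2 three≤n reach-2 below
    where
    reach-2 : reach G 2 u v ≡ true
    reach-2 = trans (cong (reach G 1 u v ∨_) (anyFin-witness n _ w (cong₂ _∧_ (reach-1-adjacent uw≡true) wv≡true)))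
                    (∨-zeroʳ _)
    below : ∀ s → s < 2 → reach G s u v ≡ false
    below zero          _ = reach-0 u≢v
    below (suc zero)    _ = trans (reach-1 u≢v) uv≡false
    below (suc (suc _)) (s≤s (s≤s ()))

  dist≤2 : ∀ u v → dist G u v ≤ 2
  dist≤2 u v with u ≟ v
  ... | yes refl rewrite dist-self u = z≤n
  ... | no u≢v with G u v in uv
  ...   | true  rewrite dist-adjacent u≢v uv    = s≤s z≤n
  ...   | false rewrite dist-nonadjacent u≢v uv = ℕ.≤-refl

  ecc≡2 : ∀ u → ecc G u ≡ 2
  ecc≡2 u with nonNeighbour u
  ... | v , u≢v , uv≡false = maxFin-attained n (dist G u) 2 v (dist≤2 u) (dist-nonadjacent u≢v uv≡false)

  eccMatrix-diagonal : ∀ u → eccMatrix G u u ≡ 0ℚ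
  eccMatrix-diagonal u rewrite ecc≡2 u | dist-self u = refl

  eccMatrix-≢ : ∀ {u v} → u ≢ v → eccMatrix G u v ≡ twoIf (not (G u v))
  eccMatrix-≢ {u} {v} u≢v rewrite ecc≡2 u | ecc≡2 v with G u v in uv
  ... | true  rewrite dist-adjacent u≢v uv    = refl
  ... | false rewrite dist-nonadjacent u≢v uv = refl

-- C (suc (suc l)) α is definitionally addPart (C (suc l) (α ∘ inject₁)) (α (fromℕ (suc l))).
addPart : Graph n → ∀ m → Graph (n + m)
addPart H m = complementG (unionG H (completeG m))

module _ (H : Graph n) (m : ℕ) where
  private
    H∪Kₘ : Graph (n + m)
    H∪Kₘ = unionG H (completeG m)

  addPart-↑ˡ↑ˡ : ∀ {x y} → x ≢ y → addPart H m (x ↑ˡ m) (y ↑ˡ m) ≡ not (H x y)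
  addPart-↑ˡ↑ˡ {x} {y} x≢y =
    trans (complementG-≢ H∪Kₘ (x≢y ∘ ↑ˡ-injective m x y)) (cong not (unionG-↑ˡ↑ˡ H (completeG m) x y))

  addPart-↑ˡ↑ʳ : ∀ x q → addPart H m (x ↑ˡ m) (n ↑ʳ q) ≡ true
  addPart-↑ˡ↑ʳ x q = trans (complementG-≢ H∪Kₘ (↑ˡ≢↑ʳ x q)) (cong not (unionG-↑ˡ↑ʳ H (completeG m) x q))

  addPart-↑ʳ↑ˡ : ∀ p y → addPart H m (n ↑ʳ p) (y ↑ˡ m) ≡ true
  addPart-↑ʳ↑ˡ p y = trans (complementG-≢ H∪Kₘ (↑ˡ≢↑ʳ y p ∘ sym)) (cong not (unionG-↑ʳ↑ˡ H (completeG m) p y))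

  addPart-↑ʳ↑ʳ : ∀ p q → addPart H m (n ↑ʳ p) (n ↑ʳ q) ≡ false
  addPart-↑ʳ↑ʳ p q with p ≟ q
  ... | yes refl rewrite dec-true (n ↑ʳ p ≟ n ↑ʳ p) refl = refl
  ... | no p≢q   = trans (complementG-≢ H∪Kₘ (p≢q ∘ ↑ʳ-injective n p q))
                         (cong not (trans (unionG-↑ʳ↑ʳ H (completeG m) p q) (cong not (dec-false (p ≟ q) p≢q))))

  addPart-noIsolated : Fin n → Fin m → ∀ u → ∃[ v ] u ≢ v × addPart H m u v ≡ true
  addPart-noIsolated z r u with side n m u
  ... | left x  = n ↑ʳ r , ↑ˡ≢↑ʳ x r , addPart-↑ˡ↑ʳ x r
  ... | right p = z ↑ˡ m , ↑ˡ≢↑ʳ z p ∘ sym , addPart-↑ʳ↑ˡ p z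

anotherFin : 2 ≤ m → (p : Fin m) → ∃[ q ] p ≢ q
anotherFin (s≤s (s≤s _)) zero    = suc zero , λ ()
anotherFin (s≤s (s≤s _)) (suc _) = zero , λ ()

addPart-selfCentred : {H : Graph n} → Fin n → (∀ x → ∃[ y ] x ≢ y × H x y ≡ true) → 2 ≤ m →
                      SelfCentredDiameterTwo (addPart H m)
addPart-selfCentred {n} {m} {H} z neighbour 2≤m = record
  { three≤n         = ℕ.+-mono-≤ (ℕ.≤-trans (s≤s z≤n) (toℕ<n z)) 2≤m
  ; commonNeighbour = λ {u} {v} → commonNeighbour (side n m u) (side n m v)
  ; nonNeighbour    = λ u → nonNeighbour (side n m u)
  }
  where
  r : Fin m
  r = fromℕ< (ℕ.≤-trans (s≤s z≤n) 2≤m)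
  commonNeighbour : ∀ {u v} → Side n m u → Side n m v → u ≢ v → addPart H m u v ≡ false →
                    ∃[ w ] addPart H m u w ≡ true × addPart H m w v ≡ true
  commonNeighbour (left x)  (left y)  _ _ = n ↑ʳ r , addPart-↑ˡ↑ʳ H m x r , addPart-↑ʳ↑ˡ H m r y
  commonNeighbour (right p) (right q) _ _ = z ↑ˡ m , addPart-↑ʳ↑ˡ H m p z , addPart-↑ˡ↑ʳ H m z q
  commonNeighbour (left x)  (right q) _ xq≡false with () ← trans (sym (addPart-↑ˡ↑ʳ H m x q)) xq≡false
  commonNeighbour (right p) (left y)  _ py≡false with () ← trans (sym (addPart-↑ʳ↑ˡ H m p y)) py≡false
  nonNeighbour : ∀ {u} → Side n m u → ∃[ v ] u ≢ v × addPart H m u v ≡ false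
  nonNeighbour (left x) with neighbour x
  ... | y , x≢y , xy≡true = y ↑ˡ m , x≢y ∘ ↑ˡ-injective m x y , trans (addPart-↑ˡ↑ˡ H m x≢y) (cong not xy≡true)
  nonNeighbour (right p) with anotherFin 2≤m p
  ... | q , p≢q = n ↑ʳ q , p≢q ∘ ↑ʳ-injective n p q , addPart-↑ʳ↑ʳ H m p q

ℕtoℚ-+ : ∀ a b → ℕtoℚ (a + b) ≡ ℕtoℚ a ℚ.+ ℕtoℚ b
ℕtoℚ-+ a b = begin
  ℕtoℚ (a + b)
    ≡⟨ ℚ./-cong (ℤ.pos-+ a b) refl ⟩
  (ℤ.+ a ℤ.+ ℤ.+ b) / 1
    ≡⟨ ℚ./-cong (sym (cong₂ ℤ._+_ (ℤ.*-identityʳ (ℤ.+ a)) (ℤ.*-identityʳ (ℤ.+ b)))) refl ⟩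
  fromℤ (ℤ.+ a) ℚ.+ fromℤ (ℤ.+ b)
    ≡⟨ cong₂ ℚ._+_ (ℚ.↥p/↧p≡p (fromℤ (ℤ.+ a))) (ℚ.↥p/↧p≡p (fromℤ (ℤ.+ b))) ⟨
  ℕtoℚ a ℚ.+ ℕtoℚ b
    ∎
  where open ≡-Reasoning

ℕtoℚ-2*suc : ∀ m → ℕtoℚ 2 ℚ.+ ℕtoℚ (2 * m) ≡ ℕtoℚ (2 * suc m)
ℕtoℚ-2*suc m = trans (sym (ℕtoℚ-+ 2 (2 * m))) (cong ℕtoℚ (sym (ℕ.*-suc 2 m)))

sumℚ-twoIf-≢ : ∀ m (p : Fin m) → sumℚ m (λ q → twoIf (not (does (p ≟ q)))) ≡ ℕtoℚ (2 * (m ∸ 1))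
sumℚ-twoIf-≢ (suc m)       zero    = trans (ℚ.+-identityˡ _) (sumℚ-two m)
  where
  sumℚ-two : ∀ m → sumℚ m (λ _ → ℕtoℚ 2) ≡ ℕtoℚ (2 * m)
  sumℚ-two zero    = refl
  sumℚ-two (suc m) = trans (cong (ℕtoℚ 2 ℚ.+_) (sumℚ-two m)) (ℕtoℚ-2*suc m)
sumℚ-twoIf-≢ (suc (suc m)) (suc p) = trans (cong (ℕtoℚ 2 ℚ.+_) (sumℚ-twoIf-≢ (suc m) p)) (ℕtoℚ-2*suc m)

addPart-lastPart-eigenMult : {H : Graph n} → SelfCentredDiameterTwo (addPart H m) → Fin m →
  EigenMultAtLeast (eccMatrix (addPart H m)) (ℕtoℚ (2 * (m ∸ 1))) 1
addPart-lastPart-eigenMult {n} {m} {H} sc r = rightIndicator-eigenMult (eccMatrix (addPart H m)) _ r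
  (λ x q → trans (eccMatrix-≢ sc (↑ˡ≢↑ʳ x q)) (cong (twoIf ∘ not) (addPart-↑ˡ↑ʳ H m x q)))
  (λ p → trans (sumℚ-cong m (lastPartEntry p)) (sumℚ-twoIf-≢ m p))
  where
  lastPartEntry : ∀ p q → eccMatrix (addPart H m) (n ↑ʳ p) (n ↑ʳ q) ≡ twoIf (not (does (p ≟ q)))
  lastPartEntry p q with p ≟ q
  ... | yes refl = eccMatrix-diagonal sc (n ↑ʳ p)
  ... | no p≢q   = trans (eccMatrix-≢ sc (p≢q ∘ ↑ʳ-injective n p q)) (cong (twoIf ∘ not) (addPart-↑ʳ↑ʳ H m p q))

C-vertex : ∀ l (α : Fin (suc l) → ℕ) → 1 ≤ α (fromℕ l) → Fin (Csize (suc l) α)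
C-vertex l α 1≤α = Csize l (α ∘ inject₁) ↑ʳ fromℕ< 1≤α

C-selfCentred : ∀ l (α : Fin (3 + l) → ℕ) → (∀ i → 1 ≤ α i) → 2 ≤ α (fromℕ (2 + l)) →
                SelfCentredDiameterTwo (C (3 + l) α)
C-selfCentred l α 1≤α 2≤α =
  addPart-selfCentred (C-vertex (suc l) α′ (1≤α _))
                      (addPart-noIsolated _ _ (C-vertex l (α′ ∘ inject₁) (1≤α _)) (fromℕ< (1≤α _))) 2≤α
  where
  α′ : Fin (2 + l) → ℕ
  α′ = α ∘ inject₁

twinFamily-eccMatrix-eigenMult : {G : Graph n} {β : Bool} → SelfCentredDiameterTwo G → TwinFamily G β k →
                                 EigenMultAtLeast (eccMatrix G) (ℚ.- twoIf (not β)) k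
twinFamily-eccMatrix-eigenMult sc =
  twinFamily-eigenMult (eccMatrix-diagonal sc) ∘ twinFamily-map (twoIf ∘ not) (eccMatrix-≢ sc)

onParity : ℕ → ℕ → ℕ → ℕ
onParity r i a = if does (i % 2 ℕ.≟ r) then a else 0

-- sumEvenPos is definitionally sumParity 1, and sumOddPos is sumParity 0.
sumParity : ℕ → (l : ℕ) → (Fin l → ℕ) → ℕ
sumParity r l α = sumℕ l (λ i → onParity r (toℕ i) (α i))

sumℕ-snoc : ∀ n (f : Fin (suc n) → ℕ) → sumℕ (suc n) f ≡ sumℕ n (f ∘ inject₁) + f (fromℕ n)
sumℕ-snoc zero    f = ℕ.+-comm (f zero) 0
sumℕ-snoc (suc n) f = trans (cong (f zero +_) (sumℕ-snoc n (f ∘ suc))) (sym (ℕ.+-assoc (f zero) _ _))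

sumParity-snoc : ∀ r n (α : Fin (suc n) → ℕ) →
                 sumParity r (suc n) α ≡ sumParity r n (α ∘ inject₁) + onParity r n (α (fromℕ n))
sumParity-snoc r n α = trans (sumℕ-snoc n (λ i → onParity r (toℕ i) (α i))) (cong₂ _+_
  (sumℕ-cong n (λ i → cong (λ t → onParity r t (α (inject₁ i))) (toℕ-inject₁ i)))
  (cong (λ t → onParity r t (α (fromℕ n))) (toℕ-fromℕ n)))
  where
  sumℕ-cong : ∀ n {f g : Fin n → ℕ} → (∀ i → f i ≡ g i) → sumℕ n f ≡ sumℕ n g
  sumℕ-cong zero    f≗g = refl
  sumℕ-cong (suc n) f≗g = cong₂ _+_ (f≗g zero) (sumℕ-cong n (f≗g ∘ suc))

onParity-periodic : ∀ r i k a → onParity r (i + k * 2) a ≡ onParity r i a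
onParity-periodic r i k a = cong (λ t → if does (t ℕ.≟ r) then a else 0) ([m+kn]%n≡m%n i k 2)

sumParity-snoc² : ∀ r j (α : Fin (suc (suc j) * 2) → ℕ) →
  sumParity r (suc (suc j) * 2) α ≡ sumParity r (suc j * 2) (α ∘ inject₁ ∘ inject₁)
                                    + onParity r 0 (α (inject₁ (fromℕ (suc j * 2))))
                                    + onParity r 1 (α (fromℕ (suc (suc j * 2))))
sumParity-snoc² r j α = begin
  sumParity r (suc (suc l)) α
    ≡⟨ sumParity-snoc r (suc l) α ⟩
  sumParity r (suc l) α′ + onParity r (suc l) αₗ
    ≡⟨ cong₂ _+_ (sumParity-snoc r l α′) (onParity-periodic r 1 (suc j) αₗ) ⟩
  sumParity r l α″ + onParity r l αₚ + onParity r 1 αₗ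
    ≡⟨ cong (λ t → sumParity r l α″ + t + onParity r 1 αₗ) (onParity-periodic r 0 (suc j) αₚ) ⟩
  sumParity r l α″ + onParity r 0 αₚ + onParity r 1 αₗ
    ∎
  where
  open ≡-Reasoning
  l αₚ αₗ : ℕ
  l  = suc j * 2
  αₚ = α (inject₁ (fromℕ l))
  αₗ = α (fromℕ (suc l))
  α′ : Fin (suc l) → ℕ
  α′ = α ∘ inject₁
  α″ : Fin l → ℕ
  α″ = α′ ∘ inject₁

t+pred[a]+suc[k]≡t+k+a : ∀ t k {a} → 1 ≤ a → t + pred a + suc k ≡ t + k + a
t+pred[a]+suc[k]≡t+k+a t k {suc a} _ = shift t k a
  where
  shift : ∀ t k a → t + a + suc k ≡ t + k + suc a
  shift = solve-∀

twinCount+k≡sumPos : ∀ j (α : Fin (suc j * 2) → ℕ) → (∀ i → 1 ≤ α i) →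
  twinCount (suc (j * 2)) α false + suc j ≡ sumEvenPos (suc j * 2) α ×
  twinCount (suc (j * 2)) α true  + suc j ≡ sumOddPos  (suc j * 2) α
twinCount+k≡sumPos zero    α 1≤α =
  trans (t+pred[a]+suc[k]≡t+k+a 0 0 (1≤α (suc zero))) (sym (ℕ.+-identityʳ _)) ,
  trans (t+pred[a]+suc[k]≡t+k+a 0 0 (1≤α zero)) (sym (ℕ.+-identityʳ _))
twinCount+k≡sumPos (suc j) α 1≤α = even , odd
  where
  open ≡-Reasoning
  l αₚ αₗ : ℕ
  l  = suc j * 2
  αₚ = α (inject₁ (fromℕ l))
  αₗ = α (fromℕ (suc l))
  α″ : Fin l → ℕ
  α″ = α ∘ inject₁ ∘ inject₁
  IH : twinCount (suc (j * 2)) α″ false + suc j ≡ sumEvenPos l α″ ×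
       twinCount (suc (j * 2)) α″ true  + suc j ≡ sumOddPos  l α″
  IH = twinCount+k≡sumPos j α″ (1≤α ∘ inject₁ ∘ inject₁)

  even : twinCount (suc l) α false + suc (suc j) ≡ sumEvenPos (suc (suc l)) α
  even = begin
    twinCount (suc (j * 2)) α″ false + pred αₗ + suc (suc j) ≡⟨ t+pred[a]+suc[k]≡t+k+a _ _ (1≤α _) ⟩
    twinCount (suc (j * 2)) α″ false + suc j + αₗ            ≡⟨ cong (_+ αₗ) (proj₁ IH) ⟩
    sumEvenPos l α″ + αₗ                                     ≡⟨ cong (_+ αₗ) (ℕ.+-identityʳ _) ⟨
    sumEvenPos l α″ + 0 + αₗ                                 ≡⟨ sumParity-snoc² 1 j α ⟨
    sumEvenPos (suc (suc l)) α                               ∎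

  odd : twinCount (suc l) α true + suc (suc j) ≡ sumOddPos (suc (suc l)) α
  odd = begin
    twinCount (suc (j * 2)) α″ true + pred αₚ + suc (suc j) ≡⟨ t+pred[a]+suc[k]≡t+k+a _ _ (1≤α _) ⟩
    twinCount (suc (j * 2)) α″ true + suc j + αₚ            ≡⟨ cong (_+ αₚ) (proj₂ IH) ⟩
    sumOddPos l α″ + αₚ                                     ≡⟨ ℕ.+-identityʳ _ ⟨
    sumOddPos l α″ + αₚ + 0                                 ≡⟨ sumParity-snoc² 0 j α ⟨
    sumOddPos (suc (suc l)) α                               ∎

m+n≡o⇒m≡o∸n : ∀ {m n o} → m + n ≡ o → m ≡ o ∸ n
m+n≡o⇒m≡o∸n {m} {n} refl = sym (ℕ.m+n∸n≡m m n)

mainTheorem2 : (k l : ℕ) → 2 ≤ k → suc l ≡ 2 * k →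
    (α : Fin (suc l) → ℕ) → (∀ i → 1 ≤ α i) → 2 ≤ α (fromℕ l) →
    EigenMultAtLeast (eccMatrix (C (suc l) α)) (-[1+ 1 ] / 1) (sumEvenPos (suc l) α ∸ k)
    × EigenMultAtLeast (eccMatrix (C (suc l) α)) 0ℚ (sumOddPos (suc l) α ∸ k)
    × EigenMultAtLeast (eccMatrix (C (suc l) α)) (ℕtoℚ (2 * (α (fromℕ l) ∸ 1))) 1
mainTheorem2 (suc (suc j)) l (s≤s (s≤s z≤n)) l+1≡2k α 1≤α 2≤α
  with refl ← ℕ.suc-injective (trans l+1≡2k (ℕ.*-comm 2 (suc (suc j)))) =
    subst (EigenMultAtLeast ε (-[1+ 1 ] / 1)) (m+n≡o⇒m≡o∸n (proj₁ counts)) (twinEigenMult false)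
  , subst (EigenMultAtLeast ε 0ℚ) (m+n≡o⇒m≡o∸n (proj₂ counts)) (twinEigenMult true)
  , addPart-lastPart-eigenMult sc (fromℕ< (1≤α _))
  where
  L : ℕ
  L = suc (suc j * 2)
  ε : Fin (Csize (suc L) α) → Fin (Csize (suc L) α) → ℚ
  ε = eccMatrix (C (suc L) α)
  sc : SelfCentredDiameterTwo (C (suc L) α)
  sc = C-selfCentred (suc (j * 2)) α 1≤α 2≤α
  twinEigenMult : ∀ β → EigenMultAtLeast ε (ℚ.- twoIf (not β)) (twinCount L α β)
  twinEigenMult β = twinFamily-eccMatrix-eigenMult sc (C-twinFamily L α β)
  counts : twinCount L α false + suc (suc j) ≡ sumEvenPos (suc L) α ×
           twinCount L α true  + suc (suc j) ≡ sumOddPos  (suc L) α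
  counts = twinCount+k≡sumPos (suc j) α 1≤α
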